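{- Let $q=2^m$ with $m\ge 3$, let $n=q+1$, let $K=\mathbb{F}_{q^2}$, and let $e$ be an integer with $\gcd(e,m)=1$; put $\sigma=2^e$. Let $$A_e=\{[1:t:t^{\sigma}:t^{\sigma+1}] : t\in\mathbb{F}_q\}\cup\{[0:0:0:1]\}\subset \mathrm{PG}(3,q),$$ let $U_n=\{u\in K^\times: u^n=1\}$, fix a generator $\beta$ of $U_n$, and put $$\mathcal M_{2^e}=\{[1:t:t^{2^e}:t^{2^e+1}]: t\in U_n\}\subset \mathrm{PG}(3,K),\qquad S_{2^e}=\mathrm{diag}(1,\beta,\beta^{2^e},\beta^{2^e+1})\in \mathrm{GL}(4,K).$$ Then $A_e$ is projectively equivalent over $K$ to $\mathcal M_{2^e}$. Moreover, one can choose $P\in\mathrm{PGL}(4,K)$ with $P(A_e)=\mathcal M_{2^e}$ such that, for some Singer element $M\in\mathrm{PGL}(2,q)$, writing $g=\varphi(M)\in\mathrm{PGL}(4,q)$, we have $P g P^{ -1}=[S_{2^e}]$ in $\mathrm{PGL}(4,K)$.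
   Context: A Singer element of $\mathrm{PGL}(2,q)$ is an element of order $q+1$. The map $\varphi:\mathrm{PGL}(2,q)\to\mathrm{PGL}(4,q)$ sends the class of $\begin{bmatrix}a&b\\ c&d\end{bmatrix}\in\mathrm{GL}(2,q)$ to the class of the matrix $$\begin{pmatrix} a^{\sigma+1} & a^{\sigma}b & ab^{\sigma} & b^{\sigma+1}\\ a^{\sigma}c & a^{\sigma}d & b^{\sigma}c & b^{\sigma}d\\ ac^{\sigma} & bc^{\sigma} & ad^{\sigma} & bd^{\sigma}\\ c^{\sigma+1} & c^{\sigma}d & cd^{\sigma} & d^{\sigma+1}\end{pmatrix},$$ with $\sigma=2^e$. Two point sets $\mathcal A,\mathcal B$ of $\mathrm{PG}(3,K)$ are projectively equivalent over $K$ if some $P\in\mathrm{PGL}(4,K)$ satisfies $P(\mathcal A)=\mathcal B$; $\mathrm{PG}(3,q)$ is viewed as a subset of $\mathrm{PG}(3,K)$. -}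

module Defs where

open import Level using (Level; _⊔_)
open import Algebra.Bundles using (CommutativeRing)
open import Data.Nat as ℕ using (ℕ; zero; suc)
open import Data.Fin using (Fin; zero; suc)
open import Data.Product using (Σ; ∃; _×_; _,_)
open import Relation.Binary.PropositionalEquality using (_≡_)
open import Relation.Nullary using (¬_)

module FieldTheory {c ℓ : Level} (K : CommutativeRing c ℓ) where
  open CommutativeRing K public hiding (zero)

  infixr 8 _^_
  _^_ : Carrier → ℕ → Carrier
  x ^ zero  = 1#
  x ^ suc n = x * (x ^ n)

  IsField : Set (c ⊔ ℓ)
  IsField = (¬ (1# ≈ 0#)) × (∀ x → ¬ (x ≈ 0#) → ∃ λ y → x * y ≈ 1#)

  HasSize : ℕ → Set (c ⊔ ℓ)
  HasSize N = Σ (Fin N → Carrier) λ f →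
                (∀ i j → f i ≈ f j → i ≡ j) × (∀ x → ∃ λ i → f i ≈ x)

  -- the subfield F_q = { x | x^q = x } of K
  InSub : ℕ → Carrier → Set ℓ
  InSub q x = x ^ q ≈ x

  Mat : ℕ → Set c
  Mat n = Fin n → Fin n → Carrier

  Vec : ℕ → Set c
  Vec n = Fin n → Carrier

  sumF : ∀ {n} → (Fin n → Carrier) → Carrier
  sumF {zero}  f = 0#
  sumF {suc n} f = f zero + sumF (λ i → f (suc i))

  _⊗_ : ∀ {n} → Mat n → Mat n → Mat n
  (A ⊗ B) i j = sumF (λ k → A i k * B k j)

  _·v_ : ∀ {n} → Mat n → Vec n → Vec n
  (A ·v v) i = sumF (λ k → A i k * v k)

  idM : ∀ {n} → Mat n
  idM zero    zero    = 1#
  idM zero    (suc j) = 0#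
  idM (suc i) zero    = 0#
  idM (suc i) (suc j) = idM i j

  scal : ∀ {n} → Carrier → Mat n → Mat n
  scal λ' A i j = λ' * A i j

  _≈M_ : ∀ {n} → Mat n → Mat n → Set ℓ
  A ≈M B = ∀ i j → A i j ≈ B i j

  _≈V_ : ∀ {n} → Vec n → Vec n → Set ℓ
  v ≈V w = ∀ i → v i ≈ w i

  mpow : ∀ {n} → Mat n → ℕ → Mat n
  mpow A zero    = idM
  mpow A (suc k) = A ⊗ mpow A k

  InverseOf : ∀ {n} → Mat n → Mat n → Set ℓ
  InverseOf A B = ((A ⊗ B) ≈M idM) × ((B ⊗ A) ≈M idM)

  IsScalar : ∀ {n} → Mat n → Set (c ⊔ ℓ)
  IsScalar A = ∃ λ μ → A ≈M scal μ idM

  -- two nonzero vectors represent the same projective point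
  Proportional : ∀ {n} → Vec n → Vec n → Set (c ⊔ ℓ)
  Proportional v w = ∃ λ λ' → (¬ (λ' ≈ 0#)) × (v ≈V scal1 λ' w)
    where scal1 : Carrier → Vec _ → Vec _
          scal1 a u i = a * u i

  -- the point set P(A) of PG(3,K) equals the point set B, where point sets
  -- are given by predicates selecting their (nonzero) representative vectors
  MapsOnto : Mat 4 → (Vec 4 → Set (c ⊔ ℓ)) → (Vec 4 → Set (c ⊔ ℓ)) → Set (c ⊔ ℓ)
  MapsOnto P A B =
    (∀ v → A v → ∃ λ w → B w × Proportional (P ·v v) w) ×
    (∀ w → B w → ∃ λ v → A v × Proportional (P ·v v) w)

  vec4 : Carrier → Carrier → Carrier → Carrier → Vec 4
  vec4 a b c' d zero = a
  vec4 a b c' d (suc zero) = b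
  vec4 a b c' d (suc (suc zero)) = c'
  vec4 a b c' d (suc (suc (suc zero))) = d

  curvePt : ℕ → Carrier → Vec 4
  curvePt σ t = vec4 1# t (t ^ σ) (t ^ (σ ℕ.+ 1))

  InA : ℕ → ℕ → Vec 4 → Set (c ⊔ ℓ)
  InA q σ v = (∃ λ t → InSub q t × (v ≈V curvePt σ t)) Data.Sum.⊎ (v ≈V vec4 0# 0# 0# 1#)
    where import Data.Sum

  InM : ℕ → ℕ → Vec 4 → Set (c ⊔ ℓ)
  InM n σ v = ∃ λ t → (t ^ n ≈ 1#) × (v ≈V curvePt σ t)

  diagS : ℕ → Carrier → Mat 4
  diagS σ β i j = diag4 i j
    where
      d : Vec 4
      d = curvePt σ β
      diag4 : Fin 4 → Fin 4 → Carrier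
      diag4 i j = idM i j * d i

  mat2 : Carrier → Carrier → Carrier → Carrier → Mat 2
  mat2 a b c' d zero zero = a
  mat2 a b c' d zero (suc zero) = b
  mat2 a b c' d (suc zero) zero = c'
  mat2 a b c' d (suc zero) (suc zero) = d

  row4 : Carrier → Carrier → Carrier → Carrier → Fin 4 → Carrier
  row4 = vec4

  φ : ℕ → Mat 2 → Mat 4
  φ σ M = go
    where
      a = M zero zero
      b = M zero (suc zero)
      c' = M (suc zero) zero
      d = M (suc zero) (suc zero)
      go : Mat 4
      go zero = row4 (a ^ (σ ℕ.+ 1)) ((a ^ σ) * b) (a * (b ^ σ)) (b ^ (σ ℕ.+ 1))
      go (suc zero) = row4 ((a ^ σ) * c') ((a ^ σ) * d) ((b ^ σ) * c') ((b ^ σ) * d)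
      go (suc (suc zero)) = row4 (a * (c' ^ σ)) (b * (c' ^ σ)) (a * (d ^ σ)) (b * (d ^ σ))
      go (suc (suc (suc zero))) = row4 (c' ^ (σ ℕ.+ 1)) ((c' ^ σ) * d) (c' * (d ^ σ)) (d ^ (σ ℕ.+ 1))

  -- M is a 2x2 matrix over F_q, invertible (in GL(2,q)), whose class in
  -- PGL(2,q) has order exactly q+1 (a Singer element)
  IsSinger : ℕ → Mat 2 → Set (c ⊔ ℓ)
  IsSinger q M =
    (∀ i j → InSub q (M i j)) ×
    (∃ λ N → (∀ i j → InSub q (N i j)) × InverseOf M N) ×
    IsScalar (mpow M (q ℕ.+ 1)) ×
    (∀ k → 0 ℕ.< k → k ℕ.< q ℕ.+ 1 → ¬ IsScalar (mpow M k))

-- Since |K| = q² is even and x ↦ -x is an involution of K whose only fixed point is 0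
-- unless 1 + 1 = 0, K has characteristic 2, so x ↦ x^σ and x ↦ x^q are additive.  Hence
-- φ(A) is the Kronecker product of the entrywise σ-th power of A with A, so φ is
-- multiplicative, and it sends v^(σ) ⊗ v to (Av)^(σ) ⊗ Av; for v = (1, t) this vector is
-- [1 : t : t^σ : t^(σ+1)], and for v = (0, 1) it is [0 : 0 : 0 : 1].
--
-- Let β̄ = β^q = β⁻¹, T = [[β̄, 1], [β, 1]], κ = 1 + β̄ and D = diag(1, β).  Then
-- M = T⁻¹ (κ D) T = [[1 + β + β̄, 1], [1, 1]] has entries in F_q, and M^k is scalar exactly
-- when β^k = 1, so M is a Singer element; P = φ(T) conjugates φ(M) to φ(κ D) = κ^(σ+1) S.
--
-- T sends [1 : t] to [β̄ + t : β + t] = [1 : u] and [0 : 1] to [1 : 1].  Applying the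
-- Frobenius x ↦ x^q to u (β̄ + t) = β + t shows that u^(q+1) = 1 when t ∈ F_q, and,
-- since t is determined by u ≠ 1, that t ∈ F_q when u^(q+1) = 1.  So P(A_e) = M_σ.

module Submission where

open import Defs
open import Level using (Level)
open import Algebra.Bundles using (CommutativeRing)
open import Data.Nat as ℕ using (ℕ; _≤_; _<_)
open import Data.Nat.GCD using (gcd)
open import Data.Product using (∃; _×_)
open import Relation.Binary.PropositionalEquality using (_≡_)
open import Relation.Nullary using (¬_)

open import Algebra.Definitions using (Involutive)
open import Data.Nat using (zero; suc)
import Data.Nat.Properties as ℕₚ
open import Data.Nat.Divisibility using (_∣_; _∣0; ∣-refl; ∣m∣n⇒∣m+n; ∣m+n∣m⇒∣n; ∣1⇒≡1; m∣m*n; ∣m⇒∣m*n)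
open import Data.Fin using (Fin; zero; suc; punchIn; punchOut)
open import Data.Fin.Properties using (_≟_; suc-injective; punchIn-punchOut; punchInᵢ≢i; punchIn-injective)
open import Data.Product using (_,_; proj₁; proj₂)
open import Data.Sum using (inj₁; inj₂)
open import Function using (_∘_)
open import Function.Bundles using (_⇔_; mk⇔; Equivalence)
open import Relation.Binary.Bundles using (Setoid)
import Relation.Binary.PropositionalEquality as ≡
open ≡ using (_≢_)
open import Relation.Nullary using (Dec; yes; no; contradiction)
import Relation.Binary.Reasoning.Setoid as SetoidReasoning
import Data.Vec.Functional.Relation.Binary.Equality.Setoid as PointwiseEquality

module InvolutionParity where
  open ≡ using (refl; sym; trans; cong; subst)

  module RemoveFixedPoint {n} (g : Fin (suc n) → Fin (suc n)) (g-involutive : Involutive _≡_ g)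
                           (p : Fin (suc n)) (gp≡p : g p ≡ p) where

    p≢g∘punchIn : ∀ x → p ≢ g (punchIn p x)
    p≢g∘punchIn x p≡g = punchInᵢ≢i p x (trans (sym (g-involutive _)) (trans (cong g (sym p≡g)) gp≡p))

    restrict : Fin n → Fin n
    restrict x = punchOut (p≢g∘punchIn x)

    punchIn-restrict : ∀ x → punchIn p (restrict x) ≡ g (punchIn p x)
    punchIn-restrict x = punchIn-punchOut (p≢g∘punchIn x)

    restrict-involutive : Involutive _≡_ restrict
    restrict-involutive x = punchIn-injective p _ _
      (trans (punchIn-restrict (restrict x)) (trans (cong g (punchIn-restrict x)) (g-involutive _)))

    restrict-fixed : ∀ x → restrict x ≡ x → g (punchIn p x) ≡ punchIn p x
    restrict-fixed x fixed = trans (sym (punchIn-restrict x)) (cong (punchIn p) fixed)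

  module RemoveZeroAndPartner {n} (g : Fin (suc n) → Fin (suc n)) (g-involutive : Involutive _≡_ g) where

    predOr : Fin n → Fin (suc n) → Fin n
    predOr x zero    = x
    predOr x (suc y) = y

    restrict : Fin n → Fin n
    restrict x = predOr x (g (suc x))

    restrict-involutive : Involutive _≡_ restrict
    restrict-involutive x with g (suc x) in eq
    ... | zero  rewrite eq = refl
    ... | suc y rewrite trans (cong g (sym eq)) (g-involutive (suc x)) = refl

    restrict-fixed : (∀ i → g i ≢ i) → ∀ x → restrict x ≡ x → g (suc x) ≡ zero
    restrict-fixed nf x fixed with g (suc x) in eq
    ... | zero  = refl
    ... | suc y = contradiction (trans eq (cong suc fixed)) (nf (suc x))

  fixedPointFree⇒even : ∀ n (g : Fin n → Fin n) → Involutive _≡_ g → (∀ i → g i ≢ i) → 2 ∣ n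
  uniqueFixedPoint⇒even : ∀ n (g : Fin (suc n) → Fin (suc n)) → Involutive _≡_ g →
                          ∀ p → g p ≡ p → (∀ i → g i ≡ i → i ≡ p) → 2 ∣ n

  fixedPointFree⇒even zero g _ _ = 2 ∣0
  fixedPointFree⇒even (suc zero) g _ nf with g zero in eq
  ... | zero = contradiction eq (nf zero)
  fixedPointFree⇒even (suc (suc n)) g g-inv nf with g zero in eq
  ... | zero  = contradiction eq (nf zero)
  ... | suc j = ∣m∣n⇒∣m+n (∣-refl {2}) (uniqueFixedPoint⇒even n restrict restrict-involutive j restrict-j≡j unique)
    where
    open RemoveZeroAndPartner g g-inv
    g-sucj≡0 : g (suc j) ≡ zero
    g-sucj≡0 = trans (cong g (sym eq)) (g-inv zero)
    restrict-j≡j : restrict j ≡ j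
    restrict-j≡j rewrite g-sucj≡0 = refl
    unique : ∀ i → restrict i ≡ i → i ≡ j
    unique i fixed = suc-injective (trans (sym (g-inv (suc i))) (trans (cong g (restrict-fixed nf i fixed)) eq))

  uniqueFixedPoint⇒even n g g-inv p gp≡p unique =
    fixedPointFree⇒even n restrict restrict-involutive
      (λ x fixed → punchInᵢ≢i p x (unique _ (restrict-fixed x fixed)))
    where open RemoveFixedPoint g g-inv p gp≡p

  uniqueFixedPoint⇒odd : ∀ {N} (g : Fin N → Fin N) → Involutive _≡_ g →
                         ∀ p → g p ≡ p → (∀ i → g i ≡ i → i ≡ p) → ¬ 2 ∣ N
  uniqueFixedPoint⇒odd {suc n} g g-inv p gp≡p unique 2∣1+n = contradiction (∣1⇒≡1 2∣1) (λ ())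
    where
    2∣1 : 2 ∣ 1
    2∣1 = ∣m+n∣m⇒∣n (subst (2 ∣_) (ℕₚ.+-comm 1 n) 2∣1+n) (uniqueFixedPoint⇒even n g g-inv p gp≡p unique)

open InvolutionParity using (uniqueFixedPoint⇒odd)

module _ {c ℓ : Level} (K : CommutativeRing c ℓ) where
  open FieldTheory K
  import Algebra.Properties.CommutativeSemiring.Exp commutativeSemiring as Exp
  open import Algebra.Properties.Semiring.Sum semiring using (sum; sum-cong-≋; sum-cong-≗; ∑-comm; *-distribˡ-sum; *-distribʳ-sum)
  open import Algebra.Solver.Ring.NaturalCoefficients.Default commutativeSemiring using (solve; _:+_; _:*_; _:=_; con)
  open import Algebra.Properties.CommutativeSemigroup *-commutativeSemigroup using (interchange; x∙yz≈y∙xz; x∙yz≈xz∙y; xy∙z≈xz∙y)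

  module ≈-Reasoning = SetoidReasoning setoid

  ≈V-setoid : ℕ → Setoid c ℓ
  ≈V-setoid = PointwiseEquality.≋-setoid setoid

  ≈M-setoid : ℕ → Setoid c ℓ
  ≈M-setoid n = PointwiseEquality.≋-setoid (≈V-setoid n) n

  module ≈V {n} = Setoid (≈V-setoid n)
  module ≈M {n} = Setoid (≈M-setoid n)
  module ≈M-Reasoning {n} = SetoidReasoning (≈M-setoid n)

  -- Powers and finite sums

  ^≡^ : ∀ x n → x ^ n ≡ x Exp.^ n
  ^≡^ x zero    = ≡.refl
  ^≡^ x (suc n) = ≡.cong (x *_) (^≡^ x n)

  ^-congˡ : ∀ n {x y} → x ≈ y → x ^ n ≈ y ^ n
  ^-congˡ n {x} {y} x≈y rewrite ^≡^ x n | ^≡^ y n = Exp.^-congˡ n x≈y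

  ^-homo-* : ∀ x m n → x ^ (m ℕ.+ n) ≈ x ^ m * x ^ n
  ^-homo-* x m n rewrite ^≡^ x (m ℕ.+ n) | ^≡^ x m | ^≡^ x n = Exp.^-homo-* x m n

  ^-distrib-* : ∀ x y n → (x * y) ^ n ≈ x ^ n * y ^ n
  ^-distrib-* x y n rewrite ^≡^ (x * y) n | ^≡^ x n | ^≡^ y n = Exp.^-distrib-* x y n

  1^n≈1 : ∀ n → 1# ^ n ≈ 1#
  1^n≈1 zero    = refl
  1^n≈1 (suc n) = trans (*-identityˡ _) (1^n≈1 n)

  x^[n+1]≈x^n*x : ∀ x n → x ^ (n ℕ.+ 1) ≈ x ^ n * x
  x^[n+1]≈x^n*x x n = trans (^-homo-* x n 1) (*-congˡ (*-identityʳ x))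

  sumF≡sum : ∀ {n} (f : Fin n → Carrier) → sumF f ≡ sum f
  sumF≡sum {zero}  f = ≡.refl
  sumF≡sum {suc n} f = ≡.cong (f zero +_) (sumF≡sum (f ∘ suc))

  sumF-cong : ∀ {n} {f g : Fin n → Carrier} → (∀ i → f i ≈ g i) → sumF f ≈ sumF g
  sumF-cong {f = f} {g} f≈g rewrite sumF≡sum f | sumF≡sum g = sum-cong-≋ f≈g

  *-distribˡ-sumF : ∀ {n} x (f : Fin n → Carrier) → x * sumF f ≈ sumF (λ i → x * f i)
  *-distribˡ-sumF x f rewrite sumF≡sum f | sumF≡sum (λ i → x * f i) = *-distribˡ-sum x f

  *-distribʳ-sumF : ∀ {n} x (f : Fin n → Carrier) → sumF f * x ≈ sumF (λ i → f i * x)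
  *-distribʳ-sumF x f rewrite sumF≡sum f | sumF≡sum (λ i → f i * x) = *-distribʳ-sum x f

  sumF-comm : ∀ {m n} (f : Fin m → Fin n → Carrier) →
              sumF (λ i → sumF (f i)) ≈ sumF (λ j → sumF (λ i → f i j))
  sumF-comm f = begin
    sumF (λ i → sumF (f i))           ≡⟨ ≡.trans (sumF≡sum (λ i → sumF (f i))) (sum-cong-≗ (sumF≡sum ∘ f)) ⟩
    sum (λ i → sum (f i))             ≈⟨ ∑-comm f ⟩
    sum (λ j → sum (λ i → f i j))     ≡⟨ ≡.trans (sumF≡sum (λ j → sumF (λ i → f i j))) (sum-cong-≗ (λ j → sumF≡sum (λ i → f i j))) ⟨
    sumF (λ j → sumF (λ i → f i j))   ∎
    where open ≈-Reasoning

  -- Matrix algebra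

  ⊗-cong : ∀ {n} {A A′ B B′ : Mat n} → A ≈M A′ → B ≈M B′ → (A ⊗ B) ≈M (A′ ⊗ B′)
  ⊗-cong A≈A′ B≈B′ i j = sumF-cong (λ k → *-cong (A≈A′ i k) (B≈B′ k j))

  ·v-cong : ∀ {n} {A A′ : Mat n} {v v′ : Vec n} → A ≈M A′ → v ≈V v′ → (A ·v v) ≈V (A′ ·v v′)
  ·v-cong A≈A′ v≈v′ i = sumF-cong (λ k → *-cong (A≈A′ i k) (v≈v′ k))

  scal-cong : ∀ {n} {a b} {A B : Mat n} → a ≈ b → A ≈M B → scal a A ≈M scal b B
  scal-cong a≈b A≈B i j = *-cong a≈b (A≈B i j)

  ⊗-assoc : ∀ {n} (A B C : Mat n) → ((A ⊗ B) ⊗ C) ≈M (A ⊗ (B ⊗ C))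
  ⊗-assoc {n} A B C i j = begin
    sumF (λ k → sumF (λ l → A i l * B l k) * C k j)
      ≈⟨ sumF-cong {n} (λ k → *-distribʳ-sumF (C k j) (λ l → A i l * B l k)) ⟩
    sumF (λ k → sumF (λ l → A i l * B l k * C k j))
      ≈⟨ sumF-comm (λ k l → A i l * B l k * C k j) ⟩
    sumF (λ l → sumF (λ k → A i l * B l k * C k j))
      ≈⟨ sumF-cong {n} (λ l → sumF-cong {n} (λ k → *-assoc (A i l) (B l k) (C k j))) ⟩
    sumF (λ l → sumF (λ k → A i l * (B l k * C k j)))
      ≈⟨ sumF-cong {n} (λ l → *-distribˡ-sumF (A i l) (λ k → B l k * C k j)) ⟨
    sumF (λ l → A i l * sumF (λ k → B l k * C k j))
      ∎
    where open ≈-Reasoning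

  sumF-0*≈0 : ∀ {n} (v : Vec n) → sumF (λ k → 0# * v k) ≈ 0#
  sumF-0*≈0 v = trans (sym (*-distribˡ-sumF 0# v)) (zeroˡ _)

  sumF-*0≈0 : ∀ {n} (v : Vec n) → sumF (λ k → v k * 0#) ≈ 0#
  sumF-*0≈0 v = trans (sym (*-distribʳ-sumF 0# v)) (zeroʳ _)

  sumF-idM-*ˡ : ∀ {n} i (v : Vec n) → sumF (λ k → idM i k * v k) ≈ v i
  sumF-idM-*ˡ zero    v = trans (+-cong (*-identityˡ _) (sumF-0*≈0 (v ∘ suc))) (+-identityʳ _)
  sumF-idM-*ˡ (suc i) v = trans (+-cong (zeroˡ _) (sumF-idM-*ˡ i (v ∘ suc))) (+-identityˡ _)

  sumF-*-idMʳ : ∀ {n} j (v : Vec n) → sumF (λ k → v k * idM k j) ≈ v j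
  sumF-*-idMʳ zero    v = trans (+-cong (*-identityʳ _) (sumF-*0≈0 (v ∘ suc))) (+-identityʳ _)
  sumF-*-idMʳ (suc j) v = trans (+-cong (zeroʳ _) (sumF-*-idMʳ j (v ∘ suc))) (+-identityˡ _)

  ⊗-identityˡ : ∀ {n} (A : Mat n) → (idM ⊗ A) ≈M A
  ⊗-identityˡ A i j = sumF-idM-*ˡ i (λ k → A k j)

  ⊗-identityʳ : ∀ {n} (A : Mat n) → (A ⊗ idM) ≈M A
  ⊗-identityʳ A i j = sumF-*-idMʳ j (A i)

  scal-⊗ˡ : ∀ {n} a (A B : Mat n) → (scal a A ⊗ B) ≈M scal a (A ⊗ B)
  scal-⊗ˡ {n} a A B i j = trans (sumF-cong {n} (λ k → *-assoc a (A i k) (B k j))) (sym (*-distribˡ-sumF a (λ k → A i k * B k j)))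

  scal-⊗ʳ : ∀ {n} a (A B : Mat n) → (A ⊗ scal a B) ≈M scal a (A ⊗ B)
  scal-⊗ʳ {n} a A B i j = trans (sumF-cong {n} (λ k → x∙yz≈y∙xz (A i k) a (B k j))) (sym (*-distribˡ-sumF a (λ k → A i k * B k j)))

  mpow-cong : ∀ {n} {A B : Mat n} → A ≈M B → ∀ k → mpow A k ≈M mpow B k
  mpow-cong A≈B zero    = ≈M.refl
  mpow-cong A≈B (suc k) = ⊗-cong A≈B (mpow-cong A≈B k)

  isScalar-resp : ∀ {n} {A B : Mat n} → A ≈M B → IsScalar A → IsScalar B
  isScalar-resp A≈B (μ , A≈μI) = μ , ≈M.trans (≈M.sym A≈B) A≈μI

  module Conjugation {n} {P Q : Mat n} (PQ≈I : (P ⊗ Q) ≈M idM) (QP≈I : (Q ⊗ P) ≈M idM) where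
    open ≈M-Reasoning

    cancel-middle : ∀ A B → ((A ⊗ Q) ⊗ (P ⊗ B)) ≈M (A ⊗ B)
    cancel-middle A B = begin
      (A ⊗ Q) ⊗ (P ⊗ B)  ≈⟨ ⊗-assoc A Q (P ⊗ B) ⟩
      A ⊗ (Q ⊗ (P ⊗ B))  ≈⟨ ⊗-cong ≈M.refl (⊗-assoc Q P B) ⟨
      A ⊗ ((Q ⊗ P) ⊗ B)  ≈⟨ ⊗-cong ≈M.refl (⊗-cong QP≈I ≈M.refl) ⟩
      A ⊗ (idM ⊗ B)      ≈⟨ ⊗-cong ≈M.refl (⊗-identityˡ B) ⟩
      A ⊗ B              ∎

    conj-⊗ : ∀ A B → ((P ⊗ (A ⊗ Q)) ⊗ (P ⊗ (B ⊗ Q))) ≈M (P ⊗ ((A ⊗ B) ⊗ Q))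
    conj-⊗ A B = begin
      (P ⊗ (A ⊗ Q)) ⊗ (P ⊗ (B ⊗ Q))  ≈⟨ ⊗-assoc P (A ⊗ Q) _ ⟩
      P ⊗ ((A ⊗ Q) ⊗ (P ⊗ (B ⊗ Q)))  ≈⟨ ⊗-cong ≈M.refl (cancel-middle A (B ⊗ Q)) ⟩
      P ⊗ (A ⊗ (B ⊗ Q))              ≈⟨ ⊗-cong ≈M.refl (⊗-assoc A B Q) ⟨
      P ⊗ ((A ⊗ B) ⊗ Q)              ∎

    conj-idM : (P ⊗ (idM ⊗ Q)) ≈M idM
    conj-idM = ≈M.trans (⊗-cong ≈M.refl (⊗-identityˡ Q)) PQ≈I

    conj-mpow : ∀ A k → mpow (P ⊗ (A ⊗ Q)) k ≈M (P ⊗ (mpow A k ⊗ Q))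
    conj-mpow A zero    = ≈M.sym conj-idM
    conj-mpow A (suc k) = ≈M.trans (⊗-cong ≈M.refl (conj-mpow A k)) (conj-⊗ A (mpow A k))

    conj-scal-idM : ∀ μ → (P ⊗ (scal μ idM ⊗ Q)) ≈M scal μ idM
    conj-scal-idM μ = begin
      P ⊗ (scal μ idM ⊗ Q)  ≈⟨ ⊗-cong ≈M.refl (scal-⊗ˡ μ idM Q) ⟩
      P ⊗ scal μ (idM ⊗ Q)  ≈⟨ scal-⊗ʳ μ P (idM ⊗ Q) ⟩
      scal μ (P ⊗ (idM ⊗ Q)) ≈⟨ scal-cong refl conj-idM ⟩
      scal μ idM            ∎

    isScalar-conj : ∀ {A} → IsScalar A → IsScalar (P ⊗ (A ⊗ Q))
    isScalar-conj (μ , A≈μI) = μ , ≈M.trans (⊗-cong ≈M.refl (⊗-cong A≈μI ≈M.refl)) (conj-scal-idM μ)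

    conj-cancel : ∀ A → (Q ⊗ ((P ⊗ (A ⊗ Q)) ⊗ P)) ≈M A
    conj-cancel A = begin
      Q ⊗ ((P ⊗ (A ⊗ Q)) ⊗ P)    ≈⟨ ⊗-cong ≈M.refl (⊗-assoc P (A ⊗ Q) P) ⟩
      Q ⊗ (P ⊗ ((A ⊗ Q) ⊗ P))    ≈⟨ ⊗-assoc Q P ((A ⊗ Q) ⊗ P) ⟨
      (Q ⊗ P) ⊗ ((A ⊗ Q) ⊗ P)    ≈⟨ ⊗-cong QP≈I ≈M.refl ⟩
      idM ⊗ ((A ⊗ Q) ⊗ P)        ≈⟨ ⊗-identityˡ ((A ⊗ Q) ⊗ P) ⟩
      (A ⊗ Q) ⊗ P                ≈⟨ ⊗-assoc A Q P ⟩
      A ⊗ (Q ⊗ P)                ≈⟨ ⊗-cong ≈M.refl QP≈I ⟩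
      A ⊗ idM                    ≈⟨ ⊗-identityʳ A ⟩
      A                          ∎

    intertwining⇒conj : ∀ {A B} → (P ⊗ A) ≈M (B ⊗ P) → (P ⊗ (A ⊗ Q)) ≈M B
    intertwining⇒conj {A} {B} PA≈BP = begin
      P ⊗ (A ⊗ Q)  ≈⟨ ⊗-assoc P A Q ⟨
      (P ⊗ A) ⊗ Q  ≈⟨ ⊗-cong PA≈BP ≈M.refl ⟩
      (B ⊗ P) ⊗ Q  ≈⟨ ⊗-assoc B P Q ⟩
      B ⊗ (P ⊗ Q)  ≈⟨ ⊗-cong ≈M.refl PQ≈I ⟩
      B ⊗ idM      ≈⟨ ⊗-identityʳ B ⟩
      B            ∎

  inverse-unique : ∀ {x y z} → x * y ≈ 1# → x * z ≈ 1# → y ≈ z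
  inverse-unique {x} {y} {z} xy≈1 xz≈1 = begin
    y            ≈⟨ *-identityˡ y ⟨
    1# * y       ≈⟨ *-congʳ xz≈1 ⟨
    (x * z) * y  ≈⟨ xy∙z≈xz∙y x z y ⟩
    (x * y) * z  ≈⟨ *-congʳ xy≈1 ⟩
    1# * z       ≈⟨ *-identityˡ z ⟩
    z            ∎
    where open ≈-Reasoning

  InSub-1 : ∀ q → InSub q 1#
  InSub-1 = 1^n≈1

  InSub-* : ∀ q {x y} → InSub q x → InSub q y → InSub q (x * y)
  InSub-* q {x} {y} xᵠ≈x yᵠ≈y = trans (^-distrib-* x y q) (*-cong xᵠ≈x yᵠ≈y)

  InSub-inverse : ∀ q {x y} → x * y ≈ 1# → InSub q x → InSub q y
  InSub-inverse q {x} {y} xy≈1 xᵠ≈x = sym (inverse-unique xy≈1 (begin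
    x * y ^ q      ≈⟨ *-congʳ xᵠ≈x ⟨
    x ^ q * y ^ q  ≈⟨ ^-distrib-* x y q ⟨
    (x * y) ^ q    ≈⟨ ^-congˡ q xy≈1 ⟩
    1# ^ q         ≈⟨ 1^n≈1 q ⟩
    1#             ∎))
    where open ≈-Reasoning

  InSub-mat2 : ∀ q {a b c′ d} → InSub q a → InSub q b → InSub q c′ → InSub q d →
               ∀ i j → InSub q (mat2 a b c′ d i j)
  InSub-mat2 q a∈ b∈ c∈ d∈ zero       zero       = a∈
  InSub-mat2 q a∈ b∈ c∈ d∈ zero       (suc zero) = b∈
  InSub-mat2 q a∈ b∈ c∈ d∈ (suc zero) zero       = c∈
  InSub-mat2 q a∈ b∈ c∈ d∈ (suc zero) (suc zero) = d∈

  InSub-scal : ∀ q {n y} {A : Mat n} → InSub q y → (∀ i j → InSub q (A i j)) → ∀ i j → InSub q (scal y A i j)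
  InSub-scal q y∈ A∈ i j = InSub-* q y∈ (A∈ i j)

  module Field (isField : IsField) where

    1≉0 : ¬ 1# ≈ 0#
    1≉0 = proj₁ isField

    inverse : ∀ x → ¬ x ≈ 0# → Carrier
    inverse x x≉0 = proj₁ (proj₂ isField x x≉0)

    x*inverse≈1 : ∀ x (x≉0 : ¬ x ≈ 0#) → x * inverse x x≉0 ≈ 1#
    x*inverse≈1 x x≉0 = proj₂ (proj₂ isField x x≉0)

    inverse-*-cancel : ∀ {a} (a≉0 : ¬ a ≈ 0#) x → inverse a a≉0 * (a * x) ≈ x
    inverse-*-cancel {a} a≉0 x = begin
      inverse a a≉0 * (a * x)  ≈⟨ x∙yz≈y∙xz _ a x ⟩
      a * (inverse a a≉0 * x)  ≈⟨ *-assoc a _ x ⟨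
      (a * inverse a a≉0) * x  ≈⟨ *-congʳ (x*inverse≈1 a a≉0) ⟩
      1# * x                   ≈⟨ *-identityˡ x ⟩
      x                        ∎
      where open ≈-Reasoning

    *-cancelˡ : ∀ {a x y} → ¬ a ≈ 0# → a * x ≈ a * y → x ≈ y
    *-cancelˡ {a} {x} {y} a≉0 ax≈ay =
      trans (sym (inverse-*-cancel a≉0 x)) (trans (*-congˡ ax≈ay) (inverse-*-cancel a≉0 y))

    x*y≉0 : ∀ {x y} → ¬ x ≈ 0# → ¬ y ≈ 0# → ¬ x * y ≈ 0#
    x*y≉0 {x} x≉0 y≉0 xy≈0 = y≉0 (*-cancelˡ x≉0 (trans xy≈0 (sym (zeroʳ x))))

    x^n≉0 : ∀ {x} n → ¬ x ≈ 0# → ¬ x ^ n ≈ 0#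
    x^n≉0 zero    x≉0 = 1≉0
    x^n≉0 (suc n) x≉0 = x*y≉0 x≉0 (x^n≉0 n x≉0)

    x≈-x⇒x≈0 : ¬ 1# + 1# ≈ 0# → ∀ {x} → x ≈ - x → x ≈ 0#
    x≈-x⇒x≈0 2≉0 {x} x≈-x = *-cancelˡ 2≉0 (begin
      (1# + 1#) * x  ≈⟨ distribʳ x 1# 1# ⟩
      1# * x + 1# * x ≈⟨ +-cong (*-identityˡ x) (*-identityˡ x) ⟩
      x + x          ≈⟨ +-congˡ x≈-x ⟩
      x + - x        ≈⟨ -‿inverseʳ x ⟩
      0#             ≈⟨ zeroʳ _ ⟨
      (1# + 1#) * 0# ∎)
      where open ≈-Reasoning

  module _ {N} (size : HasSize N) where

    private
      index : Carrier → Fin N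
      index x = proj₁ (proj₂ (proj₂ size) x)

      element : Fin N → Carrier
      element = proj₁ size

      element-index : ∀ x → element (index x) ≈ x
      element-index x = proj₂ (proj₂ (proj₂ size) x)

      element-injective : ∀ i j → element i ≈ element j → i ≡ j
      element-injective = proj₁ (proj₂ size)

    ≈-dec : ∀ x y → Dec (x ≈ y)
    ≈-dec x y with index x ≟ index y
    ... | yes eq = yes (trans (sym (element-index x)) (trans (reflexive (≡.cong element eq)) (element-index y)))
    ... | no neq = no (λ x≈y → neq (element-injective _ _
                          (trans (element-index x) (trans x≈y (sym (element-index y))))))

    evenSize⇒char2 : IsField → 2 ∣ N → 1# + 1# ≈ 0#
    evenSize⇒char2 isField 2∣N with ≈-dec (1# + 1#) 0#
    ... | yes 2≈0 = 2≈0
    ... | no 2≉0  = contradiction 2∣N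
                      (uniqueFixedPoint⇒odd negate negate-involutive (index 0#) negate-0 negate-fixed⇒0)
      where
      open Field isField using (x≈-x⇒x≈0)
      open import Algebra.Properties.Ring ring using (-‿involutive; -0#≈0#)

      negate : Fin N → Fin N
      negate i = index (- element i)

      element-negate : ∀ i → element (negate i) ≈ - element i
      element-negate i = element-index (- element i)

      negate-involutive : ∀ i → negate (negate i) ≡ i
      negate-involutive i = element-injective _ _
        (trans (element-negate _) (trans (-‿cong (element-negate i)) (-‿involutive _)))

      negate-0 : negate (index 0#) ≡ index 0#
      negate-0 = element-injective _ _
        (trans (element-negate _) (trans (-‿cong (element-index 0#)) (trans -0#≈0# (sym (element-index 0#)))))

      negate-fixed⇒0 : ∀ i → negate i ≡ i → i ≡ index 0#
      negate-fixed⇒0 i fixed = element-injective _ _ (trans (x≈-x⇒x≈0 2≉0 x≈-x) (sym (element-index 0#)))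
        where
        x≈-x : element i ≈ - element i
        x≈-x = trans (sym (reflexive (≡.cong element fixed))) (element-negate i)

  module Char2 (1+1≈0 : 1# + 1# ≈ 0#) where
    open import Algebra.Properties.Ring ring using (+-inverseˡ-unique)

    x+x≈0 : ∀ x → x + x ≈ 0#
    x+x≈0 x = begin
      x + x            ≈⟨ +-cong (*-identityˡ x) (*-identityˡ x) ⟨
      1# * x + 1# * x  ≈⟨ distribʳ x 1# 1# ⟨
      (1# + 1#) * x    ≈⟨ *-congʳ 1+1≈0 ⟩
      0# * x           ≈⟨ zeroˡ x ⟩
      0#               ∎
      where open ≈-Reasoning

    x+[y+y]≈x : ∀ x y → x + (y + y) ≈ x
    x+[y+y]≈x x y = trans (+-congˡ (x+x≈0 y)) (+-identityʳ x)

    x+y≈0⇒x≈y : ∀ {x y} → x + y ≈ 0# → x ≈ y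
    x+y≈0⇒x≈y {x} {y} x+y≈0 = trans (+-inverseˡ-unique x y x+y≈0) (sym (+-inverseˡ-unique y y (x+x≈0 y)))

    +-exchange : ∀ {a b c d} → a + b ≈ c + d → a + c ≈ b + d
    +-exchange {a} {b} {c} {d} a+b≈c+d = begin
      a + c                  ≈⟨ x+[y+y]≈x (a + c) b ⟨
      (a + c) + (b + b)      ≈⟨ solve 3 (λ a b c → (a :+ c) :+ (b :+ b) := (a :+ b) :+ (c :+ b)) refl a b c ⟩
      (a + b) + (c + b)      ≈⟨ +-congʳ a+b≈c+d ⟩
      (c + d) + (c + b)      ≈⟨ solve 3 (λ b c d → (c :+ d) :+ (c :+ b) := (b :+ d) :+ (c :+ c)) refl b c d ⟩
      (b + d) + (c + c)      ≈⟨ x+[y+y]≈x (b + d) c ⟩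
      b + d                  ∎
      where open ≈-Reasoning

    ^-double : ∀ x k → x ^ (2 ℕ.^ suc k) ≈ x ^ (2 ℕ.^ k) * x ^ (2 ℕ.^ k)
    ^-double x k = trans (reflexive (≡.cong (λ n → x ^ (Q ℕ.+ n)) (ℕₚ.+-identityʳ Q))) (^-homo-* x Q Q)
      where
      Q : ℕ
      Q = 2 ℕ.^ k

    frobenius : ∀ k x y → (x + y) ^ (2 ℕ.^ k) ≈ x ^ (2 ℕ.^ k) + y ^ (2 ℕ.^ k)
    frobenius zero    x y = distribʳ 1# x y
    frobenius (suc k) x y = begin
      (x + y) ^ (2 ℕ.^ suc k)                 ≈⟨ ^-double (x + y) k ⟩
      (x + y) ^ Q * (x + y) ^ Q               ≈⟨ *-cong (frobenius k x y) (frobenius k x y) ⟩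
      (a + b) * (a + b)                       ≈⟨ solve 2 (λ a b → (a :+ b) :* (a :+ b) := (a :* a :+ b :* b) :+ (a :* b :+ a :* b)) refl a b ⟩
      (a * a + b * b) + (a * b + a * b)       ≈⟨ x+[y+y]≈x _ (a * b) ⟩
      a * a + b * b                           ≈⟨ +-cong (^-double x k) (^-double y k) ⟨
      x ^ (2 ℕ.^ suc k) + y ^ (2 ℕ.^ suc k)   ∎
      where
      open ≈-Reasoning
      Q : ℕ
      Q = 2 ℕ.^ k
      a b : Carrier
      a = x ^ Q
      b = y ^ Q

    InSub-+ : ∀ k {x y} → InSub (2 ℕ.^ k) x → InSub (2 ℕ.^ k) y → InSub (2 ℕ.^ k) (x + y)
    InSub-+ k {x} {y} xᵠ≈x yᵠ≈y = trans (frobenius k x y) (+-cong xᵠ≈x yᵠ≈y)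

    -- In characteristic 2 the adjugate needs no signs.
    mat2-inverse : ∀ {a b c d y} → (a * d + b * c) * y ≈ 1# →
                   InverseOf (mat2 a b c d) (scal y (mat2 d b c a))
    mat2-inverse {a} {b} {c} {d} {y} det*y≈1 = right , left
      where
      right : (mat2 a b c d ⊗ scal y (mat2 d b c a)) ≈M idM
      right zero       zero       = trans (solve 5 (λ a b c d y →
        a :* (y :* d) :+ (b :* (y :* c) :+ con 0) := (a :* d :+ b :* c) :* y) refl a b c d y) det*y≈1
      right zero       (suc zero) = trans (solve 3 (λ a b y →
        a :* (y :* b) :+ (b :* (y :* a) :+ con 0) := a :* b :* y :+ a :* b :* y) refl a b y) (x+x≈0 _)
      right (suc zero) zero       = trans (solve 3 (λ c d y →
        c :* (y :* d) :+ (d :* (y :* c) :+ con 0) := c :* d :* y :+ c :* d :* y) refl c d y) (x+x≈0 _)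
      right (suc zero) (suc zero) = trans (solve 5 (λ a b c d y →
        c :* (y :* b) :+ (d :* (y :* a) :+ con 0) := (a :* d :+ b :* c) :* y) refl a b c d y) det*y≈1

      left : (scal y (mat2 d b c a) ⊗ mat2 a b c d) ≈M idM
      left zero       zero       = trans (solve 5 (λ a b c d y →
        y :* d :* a :+ (y :* b :* c :+ con 0) := (a :* d :+ b :* c) :* y) refl a b c d y) det*y≈1
      left zero       (suc zero) = trans (solve 3 (λ b d y →
        y :* d :* b :+ (y :* b :* d :+ con 0) := b :* d :* y :+ b :* d :* y) refl b d y) (x+x≈0 _)
      left (suc zero) zero       = trans (solve 3 (λ a c y →
        y :* c :* a :+ (y :* a :* c :+ con 0) := a :* c :* y :+ a :* c :* y) refl a c y) (x+x≈0 _)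
      left (suc zero) (suc zero) = trans (solve 5 (λ a b c d y →
        y :* c :* b :+ (y :* a :* d :+ con 0) := (a :* d :+ b :* c) :* y) refl a b c d y) det*y≈1

  vec2 : Carrier → Carrier → Vec 2
  vec2 x y zero       = x
  vec2 x y (suc zero) = y

  diag2 : Carrier → Carrier → Mat 2
  diag2 a b = mat2 a 0# 0# b

  idM≈diag2 : idM ≈M diag2 1# 1#
  idM≈diag2 zero       zero       = refl
  idM≈diag2 zero       (suc zero) = refl
  idM≈diag2 (suc zero) zero       = refl
  idM≈diag2 (suc zero) (suc zero) = refl

  diag2-⊗ : ∀ a b c d → (diag2 a b ⊗ diag2 c d) ≈M diag2 (a * c) (b * d)
  diag2-⊗ a b c d zero       zero       = solve 2 (λ a c → a :* c :+ (con 0 :* con 0 :+ con 0) := a :* c) refl a c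
  diag2-⊗ a b c d zero       (suc zero) = solve 2 (λ a d → a :* con 0 :+ (con 0 :* d :+ con 0) := con 0) refl a d
  diag2-⊗ a b c d (suc zero) zero       = solve 2 (λ b c → con 0 :* c :+ (b :* con 0 :+ con 0) := con 0) refl b c
  diag2-⊗ a b c d (suc zero) (suc zero) = solve 2 (λ b d → con 0 :* con 0 :+ (b :* d :+ con 0) := b :* d) refl b d

  mpow-diag2 : ∀ a b k → mpow (diag2 a b) k ≈M diag2 (a ^ k) (b ^ k)
  mpow-diag2 a b zero    = idM≈diag2
  mpow-diag2 a b (suc k) = ≈M.trans (⊗-cong {A = diag2 a b} ≈M.refl (mpow-diag2 a b k)) (diag2-⊗ a b (a ^ k) (b ^ k))

  scal-diag2 : ∀ a b c → scal a (diag2 b c) ≈M diag2 (a * b) (a * c)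
  scal-diag2 a b c zero       zero       = refl
  scal-diag2 a b c zero       (suc zero) = zeroʳ a
  scal-diag2 a b c (suc zero) zero       = zeroʳ a
  scal-diag2 a b c (suc zero) (suc zero) = refl

  ≈⇒isScalar-diag2 : ∀ {a b} → a ≈ b → IsScalar (diag2 a b)
  ≈⇒isScalar-diag2 {a} a≈b = a , D≈aI
    where
    D≈aI : diag2 a _ ≈M scal a idM
    D≈aI zero       zero       = sym (*-identityʳ a)
    D≈aI zero       (suc zero) = sym (zeroʳ a)
    D≈aI (suc zero) zero       = sym (zeroʳ a)
    D≈aI (suc zero) (suc zero) = trans (sym a≈b) (sym (*-identityʳ a))

  isScalar-diag2⇒≈ : ∀ {a b} → IsScalar (diag2 a b) → a ≈ b
  isScalar-diag2⇒≈ (μ , D≈μI) = trans (D≈μI zero zero) (sym (D≈μI (suc zero) (suc zero)))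

  -- Fin 4 ≅ Fin 2 × Fin 2 via r = 2 · hi r + lo r, the coordinate order used by φ.
  hi lo : Fin 4 → Fin 2
  hi zero                   = zero
  hi (suc zero)             = zero
  hi (suc (suc zero))       = suc zero
  hi (suc (suc (suc zero))) = suc zero
  lo zero                   = zero
  lo (suc zero)             = suc zero
  lo (suc (suc zero))       = zero
  lo (suc (suc (suc zero))) = suc zero

  kron : Mat 2 → Mat 2 → Mat 4
  kron A B r s = A (hi r) (hi s) * B (lo r) (lo s)

  kronV : Vec 2 → Vec 2 → Vec 4
  kronV v w r = v (hi r) * w (lo r)

  kron-cong : ∀ {A A′ B B′} → A ≈M A′ → B ≈M B′ → kron A B ≈M kron A′ B′
  kron-cong A≈A′ B≈B′ r s = *-cong (A≈A′ (hi r) (hi s)) (B≈B′ (lo r) (lo s))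

  kron-⊗ : ∀ A B C D → (kron A B ⊗ kron C D) ≈M kron (A ⊗ C) (B ⊗ D)
  kron-⊗ A B C D r s = solve 8 (λ a₀ a₁ b₀ b₁ c₀ c₁ d₀ d₁ →
      (a₀ :* b₀) :* (c₀ :* d₀) :+ ((a₀ :* b₁) :* (c₀ :* d₁) :+ ((a₁ :* b₀) :* (c₁ :* d₀) :+ ((a₁ :* b₁) :* (c₁ :* d₁) :+ con 0)))
      := (a₀ :* c₀ :+ (a₁ :* c₁ :+ con 0)) :* (b₀ :* d₀ :+ (b₁ :* d₁ :+ con 0)))
    refl (A (hi r) zero) (A (hi r) (suc zero)) (B (lo r) zero) (B (lo r) (suc zero))
         (C zero (hi s)) (C (suc zero) (hi s)) (D zero (lo s)) (D (suc zero) (lo s))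

  kron-·v : ∀ A B v w → (kron A B ·v kronV v w) ≈V kronV (A ·v v) (B ·v w)
  kron-·v A B v w r = solve 8 (λ a₀ a₁ b₀ b₁ v₀ v₁ w₀ w₁ →
      (a₀ :* b₀) :* (v₀ :* w₀) :+ ((a₀ :* b₁) :* (v₀ :* w₁) :+ ((a₁ :* b₀) :* (v₁ :* w₀) :+ ((a₁ :* b₁) :* (v₁ :* w₁) :+ con 0)))
      := (a₀ :* v₀ :+ (a₁ :* v₁ :+ con 0)) :* (b₀ :* w₀ :+ (b₁ :* w₁ :+ con 0)))
    refl (A (hi r) zero) (A (hi r) (suc zero)) (B (lo r) zero) (B (lo r) (suc zero))
         (v zero) (v (suc zero)) (w zero) (w (suc zero))

  kron-scal : ∀ a b A B → kron (scal a A) (scal b B) ≈M scal (a * b) (kron A B)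
  kron-scal a b A B r s = interchange a _ b _

  kronV-scal : ∀ a b v w → kronV (λ i → a * v i) (λ i → b * w i) ≈V (λ r → (a * b) * kronV v w r)
  kronV-scal a b v w r = interchange a _ b _

  module TwistedTensorSquare (σ : ℕ) (σ-additive : ∀ x y → (x + y) ^ σ ≈ x ^ σ + y ^ σ) where
    open import Algebra.Properties.Ring ring using (x+x≈x⇒x≈0)

    0^σ≈0 : 0# ^ σ ≈ 0#
    0^σ≈0 = x+x≈x⇒x≈0 _ (trans (sym (σ-additive 0# 0#)) (^-congˡ σ (+-identityʳ 0#)))

    frobM : ∀ {n} → Mat n → Mat n
    frobM A i j = A i j ^ σ

    frobV : ∀ {n} → Vec n → Vec n
    frobV v i = v i ^ σ

    sumF-^σ : ∀ {n} (f : Fin n → Carrier) → sumF f ^ σ ≈ sumF (λ i → f i ^ σ)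
    sumF-^σ {zero}  f = 0^σ≈0
    sumF-^σ {suc n} f = trans (σ-additive _ _) (+-congˡ (sumF-^σ (f ∘ suc)))

    frobM-cong : ∀ {n} {A B : Mat n} → A ≈M B → frobM A ≈M frobM B
    frobM-cong A≈B i j = ^-congˡ σ (A≈B i j)

    frobM-⊗ : ∀ {n} (A B : Mat n) → frobM (A ⊗ B) ≈M (frobM A ⊗ frobM B)
    frobM-⊗ {n} A B i j =
      trans (sumF-^σ (λ k → A i k * B k j)) (sumF-cong {n} (λ k → ^-distrib-* (A i k) (B k j) σ))

    frobV-·v : ∀ {n} (A : Mat n) v → frobV (A ·v v) ≈V (frobM A ·v frobV v)
    frobV-·v {n} A v i =
      trans (sumF-^σ (λ k → A i k * v k)) (sumF-cong {n} (λ k → ^-distrib-* (A i k) (v k) σ))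

    frobM-scal : ∀ {n} a (A : Mat n) → frobM (scal a A) ≈M scal (a ^ σ) (frobM A)
    frobM-scal a A i j = ^-distrib-* a (A i j) σ

    x^[σ+1]≈x^σ*x : ∀ x → x ^ (σ ℕ.+ 1) ≈ x ^ σ * x
    x^[σ+1]≈x^σ*x x = x^[n+1]≈x^n*x x σ

    φ-kron : ∀ A → φ σ A ≈M kron (frobM A) A
    φ-kron A zero                   zero                   = x^[σ+1]≈x^σ*x _
    φ-kron A zero                   (suc zero)             = refl
    φ-kron A zero                   (suc (suc zero))       = *-comm _ _
    φ-kron A zero                   (suc (suc (suc zero))) = x^[σ+1]≈x^σ*x _
    φ-kron A (suc zero)             zero                   = refl
    φ-kron A (suc zero)             (suc zero)             = refl
    φ-kron A (suc zero)             (suc (suc zero))       = refl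
    φ-kron A (suc zero)             (suc (suc (suc zero))) = refl
    φ-kron A (suc (suc zero))       zero                   = *-comm _ _
    φ-kron A (suc (suc zero))       (suc zero)             = *-comm _ _
    φ-kron A (suc (suc zero))       (suc (suc zero))       = *-comm _ _
    φ-kron A (suc (suc zero))       (suc (suc (suc zero))) = *-comm _ _
    φ-kron A (suc (suc (suc zero))) zero                   = x^[σ+1]≈x^σ*x _
    φ-kron A (suc (suc (suc zero))) (suc zero)             = refl
    φ-kron A (suc (suc (suc zero))) (suc (suc zero))       = *-comm _ _
    φ-kron A (suc (suc (suc zero))) (suc (suc (suc zero))) = x^[σ+1]≈x^σ*x _

    φ-cong : ∀ {A B} → A ≈M B → φ σ A ≈M φ σ B
    φ-cong {A} {B} A≈B = ≈M.trans (φ-kron A) (≈M.trans (kron-cong (frobM-cong A≈B) A≈B) (≈M.sym (φ-kron B)))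

    φ-⊗ : ∀ A B → φ σ (A ⊗ B) ≈M (φ σ A ⊗ φ σ B)
    φ-⊗ A B = begin
      φ σ (A ⊗ B)                              ≈⟨ φ-kron (A ⊗ B) ⟩
      kron (frobM (A ⊗ B)) (A ⊗ B)             ≈⟨ kron-cong {B = A ⊗ B} (frobM-⊗ A B) ≈M.refl ⟩
      kron (frobM A ⊗ frobM B) (A ⊗ B)         ≈⟨ kron-⊗ (frobM A) A (frobM B) B ⟨
      kron (frobM A) A ⊗ kron (frobM B) B      ≈⟨ ⊗-cong (φ-kron A) (φ-kron B) ⟨
      φ σ A ⊗ φ σ B                            ∎
      where open ≈M-Reasoning

    φ-scal : ∀ a A → φ σ (scal a A) ≈M scal (a ^ σ * a) (φ σ A)
    φ-scal a A = begin
      φ σ (scal a A)                              ≈⟨ φ-kron (scal a A) ⟩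
      kron (frobM (scal a A)) (scal a A)          ≈⟨ kron-cong {B = scal a A} (frobM-scal a A) ≈M.refl ⟩
      kron (scal (a ^ σ) (frobM A)) (scal a A)    ≈⟨ kron-scal (a ^ σ) a (frobM A) A ⟩
      scal (a ^ σ * a) (kron (frobM A) A)         ≈⟨ scal-cong refl (φ-kron A) ⟨
      scal (a ^ σ * a) (φ σ A)                    ∎
      where open ≈M-Reasoning

    frobM-diag2 : ∀ b → frobM (diag2 1# b) ≈M diag2 1# (b ^ σ)
    frobM-diag2 b zero       zero       = 1^n≈1 σ
    frobM-diag2 b zero       (suc zero) = 0^σ≈0
    frobM-diag2 b (suc zero) zero       = 0^σ≈0
    frobM-diag2 b (suc zero) (suc zero) = refl

    kron-diag2 : ∀ b → kron (diag2 1# (b ^ σ)) (diag2 1# b) ≈M diagS σ b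
    kron-diag2 b = table
      where
      x*0≈0*y : ∀ {x y} → x * 0# ≈ 0# * y
      x*0≈0*y = trans (zeroʳ _) (sym (zeroˡ _))
      0*x≈0*y : ∀ {x y} → 0# * x ≈ 0# * y
      0*x≈0*y = trans (zeroˡ _) (sym (zeroˡ _))
      table : kron (diag2 1# (b ^ σ)) (diag2 1# b) ≈M diagS σ b
      table zero                   zero                   = refl
      table zero                   (suc zero)             = x*0≈0*y
      table zero                   (suc (suc zero))       = 0*x≈0*y
      table zero                   (suc (suc (suc zero))) = 0*x≈0*y
      table (suc zero)             zero                   = x*0≈0*y
      table (suc zero)             (suc zero)             = refl
      table (suc zero)             (suc (suc zero))       = 0*x≈0*y
      table (suc zero)             (suc (suc (suc zero))) = 0*x≈0*y
      table (suc (suc zero))       zero                   = 0*x≈0*y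
      table (suc (suc zero))       (suc zero)             = 0*x≈0*y
      table (suc (suc zero))       (suc (suc zero))       = *-comm _ _
      table (suc (suc zero))       (suc (suc (suc zero))) = x*0≈0*y
      table (suc (suc (suc zero))) zero                   = 0*x≈0*y
      table (suc (suc (suc zero))) (suc zero)             = 0*x≈0*y
      table (suc (suc (suc zero))) (suc (suc zero))       = x*0≈0*y
      table (suc (suc (suc zero))) (suc (suc (suc zero))) = trans (sym (x^[σ+1]≈x^σ*x b)) (sym (*-identityˡ _))

    φ-diag2 : ∀ b → φ σ (diag2 1# b) ≈M diagS σ b
    φ-diag2 b = ≈M.trans (φ-kron (diag2 1# b)) (≈M.trans (kron-cong {B = diag2 1# b} (frobM-diag2 b) ≈M.refl) (kron-diag2 b))

    diagS-1 : diagS σ 1# ≈M idM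
    diagS-1 r s = trans (*-congˡ (curvePt-1 r)) (*-identityʳ _)
      where
      curvePt-1 : ∀ r → curvePt σ 1# r ≈ 1#
      curvePt-1 zero                   = refl
      curvePt-1 (suc zero)             = refl
      curvePt-1 (suc (suc zero))       = 1^n≈1 σ
      curvePt-1 (suc (suc (suc zero))) = 1^n≈1 (σ ℕ.+ 1)

    φ-idM : φ σ idM ≈M idM
    φ-idM = ≈M.trans (φ-cong idM≈diag2) (≈M.trans (φ-diag2 1#) diagS-1)

    φ-inverse : ∀ {A B} → InverseOf A B → InverseOf (φ σ A) (φ σ B)
    φ-inverse {A} {B} (AB≈I , BA≈I) = preserves {A} {B} AB≈I , preserves {B} {A} BA≈I
      where
      preserves : ∀ {C D} → (C ⊗ D) ≈M idM → (φ σ C ⊗ φ σ D) ≈M idM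
      preserves {C} {D} CD≈I = ≈M.trans (≈M.sym (φ-⊗ C D)) (≈M.trans (φ-cong {C ⊗ D} CD≈I) φ-idM)

    tens : Vec 2 → Vec 4
    tens v = kronV (frobV v) v

    tens-cong : ∀ {v w} → v ≈V w → tens v ≈V tens w
    tens-cong v≈w r = *-cong (^-congˡ σ (v≈w (hi r))) (v≈w (lo r))

    φ-tens : ∀ A v → (φ σ A ·v tens v) ≈V tens (A ·v v)
    φ-tens A v r = begin
      (φ σ A ·v tens v) r                            ≈⟨ ·v-cong {v = tens v} (φ-kron A) ≈V.refl r ⟩
      (kron (frobM A) A ·v kronV (frobV v) v) r      ≈⟨ kron-·v (frobM A) A (frobV v) v r ⟩
      (frobM A ·v frobV v) (hi r) * (A ·v v) (lo r)  ≈⟨ *-congʳ (frobV-·v A v (hi r)) ⟨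
      tens (A ·v v) r                                ∎
      where open ≈-Reasoning

    tens-scal : ∀ a v → tens (λ i → a * v i) ≈V (λ r → (a ^ σ * a) * tens v r)
    tens-scal a v r =
      trans (*-congʳ (^-distrib-* a (v (hi r)) σ)) (kronV-scal (a ^ σ) a (frobV v) v r)

    curvePt≈tens : ∀ t → curvePt σ t ≈V tens (vec2 1# t)
    curvePt≈tens t zero                   = sym (trans (*-congʳ (1^n≈1 σ)) (*-identityˡ 1#))
    curvePt≈tens t (suc zero)             = sym (trans (*-congʳ (1^n≈1 σ)) (*-identityˡ t))
    curvePt≈tens t (suc (suc zero))       = sym (*-identityʳ _)
    curvePt≈tens t (suc (suc (suc zero))) = x^[σ+1]≈x^σ*x t

    e₄≈tens : vec4 0# 0# 0# 1# ≈V tens (vec2 0# 1#)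
    e₄≈tens zero                   = sym (zeroʳ _)
    e₄≈tens (suc zero)             = sym (trans (*-congʳ 0^σ≈0) (zeroˡ 1#))
    e₄≈tens (suc (suc zero))       = sym (zeroʳ _)
    e₄≈tens (suc (suc (suc zero))) = sym (trans (*-congʳ (1^n≈1 σ)) (*-identityˡ 1#))

    tens-vec2 : ∀ {a b u} → b ≈ a * u → tens (vec2 a b) ≈V (λ r → (a ^ σ * a) * curvePt σ u r)
    tens-vec2 {a} {b} {u} b≈au r = begin
      tens (vec2 a b) r                       ≈⟨ tens-cong a•[1,u] r ⟩
      tens (λ i → a * vec2 1# u i) r          ≈⟨ tens-scal a (vec2 1# u) r ⟩
      (a ^ σ * a) * tens (vec2 1# u) r        ≈⟨ *-congˡ (curvePt≈tens u r) ⟨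
      (a ^ σ * a) * curvePt σ u r             ∎
      where
      open ≈-Reasoning
      a•[1,u] : vec2 a b ≈V (λ i → a * vec2 1# u i)
      a•[1,u] zero       = sym (*-identityʳ a)
      a•[1,u] (suc zero) = b≈au

  module SingerConjugation (isField : IsField) (1+1≈0 : 1# + 1# ≈ 0#) (_≟K_ : ∀ x y → Dec (x ≈ y))
                           (m : ℕ) (1≤m : 1 ≤ m) (e : ℕ) (β : Carrier)
                           (β^[q+1]≈1 : β ^ (2 ℕ.^ m ℕ.+ 1) ≈ 1#)
                           (β-order : ∀ k → 0 < k → k < 2 ℕ.^ m ℕ.+ 1 → ¬ (β ^ k ≈ 1#)) where
    open Field isField
    open Char2 1+1≈0

    q σ : ℕ
    q = 2 ℕ.^ m
    σ = 2 ℕ.^ e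

    open TwistedTensorSquare σ (frobenius e)

    2<q+1 : 2 < q ℕ.+ 1
    2<q+1 = ℕₚ.+-monoˡ-≤ 1 (ℕₚ.^-monoʳ-≤ 2 1≤m)

    x^[q+1]≈x*x^q : ∀ x → x ^ (q ℕ.+ 1) ≈ x * x ^ q
    x^[q+1]≈x*x^q x = reflexive (≡.cong (x ^_) (ℕₚ.+-comm q 1))

    β̄ : Carrier
    β̄ = β ^ q

    β*β̄≈1 : β * β̄ ≈ 1#
    β*β̄≈1 = trans (sym (x^[q+1]≈x*x^q β)) β^[q+1]≈1

    β̄^q≈β : β̄ ^ q ≈ β
    β̄^q≈β = inverse-unique β̄*β̄^q≈1 (trans (*-comm β̄ β) β*β̄≈1)
      where
      β̄*β̄^q≈1 : β̄ * β̄ ^ q ≈ 1#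
      β̄*β̄^q≈1 = trans (sym (^-distrib-* β β̄ q)) (trans (^-congˡ q β*β̄≈1) (1^n≈1 q))

    β≉1 : ¬ β ≈ 1#
    β≉1 β≈1 = β-order 1 (ℕ.s≤s ℕ.z≤n) (ℕₚ.<-trans (ℕₚ.n<1+n 1) 2<q+1) (trans (*-identityʳ β) β≈1)

    β≉β̄ : ¬ β ≈ β̄
    β≉β̄ β≈β̄ = β-order 2 (ℕ.s≤s ℕ.z≤n) 2<q+1 (trans (*-congˡ (trans (*-identityʳ β) β≈β̄)) β*β̄≈1)

    κ : Carrier
    κ = 1# + β̄

    κ≉0 : ¬ κ ≈ 0#
    κ≉0 κ≈0 = β≉1 (begin
      β        ≈⟨ *-identityʳ β ⟨
      β * 1#   ≈⟨ *-congˡ (x+y≈0⇒x≈y κ≈0) ⟩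
      β * β̄    ≈⟨ β*β̄≈1 ⟩
      1#       ∎)
      where open ≈-Reasoning

    κ*β≈β+1 : κ * β ≈ β + 1#
    κ*β≈β+1 = trans (solve 2 (λ β β̄ → (con 1 :+ β̄) :* β := β :+ β :* β̄) refl β β̄) (+-congˡ β*β̄≈1)

    x+[ββ̄+1]≈x : ∀ x → x + (β * β̄ + 1#) ≈ x
    x+[ββ̄+1]≈x x = trans (+-congˡ (trans (+-congʳ β*β̄≈1) 1+1≈0)) (+-identityʳ x)

    T : Mat 2
    T = mat2 β̄ 1# β 1#

    detT≉0 : ¬ β̄ * 1# + 1# * β ≈ 0#
    detT≉0 detT≈0 = β≉β̄ (sym (x+y≈0⇒x≈y (trans (+-cong (sym (*-identityʳ β̄)) (sym (*-identityˡ β))) detT≈0)))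

    T⁻¹ : Mat 2
    T⁻¹ = scal (inverse _ detT≉0) (mat2 1# 1# β β̄)

    T-inverse : InverseOf T T⁻¹
    T-inverse = mat2-inverse (x*inverse≈1 _ detT≉0)

    s : Carrier
    s = 1# + (β + β̄)

    M : Mat 2
    M = mat2 s 1# 1# 1#

    D : Mat 2
    D = diag2 1# β

    T⊗M≈κD⊗T : (T ⊗ M) ≈M (scal κ D ⊗ T)
    T⊗M≈κD⊗T zero zero = begin
      β̄ * s + (1# * 1# + 0#)                   ≈⟨ solve 2 (λ β β̄ → β̄ :* (con 1 :+ (β :+ β̄)) :+ (con 1 :* con 1 :+ con 0) := (con 1 :+ β̄) :* con 1 :* β̄ :+ ((con 1 :+ β̄) :* con 0 :* β :+ con 0) :+ (β :* β̄ :+ con 1)) refl β β̄ ⟩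
      (κ * 1# * β̄ + (κ * 0# * β + 0#)) + (β * β̄ + 1#) ≈⟨ x+[ββ̄+1]≈x _ ⟩
      κ * 1# * β̄ + (κ * 0# * β + 0#)            ∎
      where open ≈-Reasoning
    T⊗M≈κD⊗T zero (suc zero) = solve 1 (λ β̄ → β̄ :* con 1 :+ (con 1 :* con 1 :+ con 0) := (con 1 :+ β̄) :* con 1 :* con 1 :+ ((con 1 :+ β̄) :* con 0 :* con 1 :+ con 0)) refl β̄
    T⊗M≈κD⊗T (suc zero) zero = begin
      β * s + (1# * 1# + 0#)                   ≈⟨ solve 2 (λ β β̄ → β :* (con 1 :+ (β :+ β̄)) :+ (con 1 :* con 1 :+ con 0) := (β :+ con 1) :* β :+ (β :* β̄ :+ con 1)) refl β β̄ ⟩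
      (β + 1#) * β + (β * β̄ + 1#)              ≈⟨ x+[ββ̄+1]≈x _ ⟩
      (β + 1#) * β                             ≈⟨ *-congʳ κ*β≈β+1 ⟨
      κ * β * β                                ≈⟨ solve 3 (λ κ β β̄ → κ :* β :* β := κ :* con 0 :* β̄ :+ (κ :* β :* β :+ con 0)) refl κ β β̄ ⟩
      κ * 0# * β̄ + (κ * β * β + 0#)            ∎
      where open ≈-Reasoning
    T⊗M≈κD⊗T (suc zero) (suc zero) = begin
      β * 1# + (1# * 1# + 0#)                  ≈⟨ solve 1 (λ β → β :* con 1 :+ (con 1 :* con 1 :+ con 0) := β :+ con 1) refl β ⟩
      β + 1#                                   ≈⟨ κ*β≈β+1 ⟨
      κ * β                                    ≈⟨ solve 2 (λ κ β → κ :* β := κ :* con 0 :* con 1 :+ (κ :* β :* con 1 :+ con 0)) refl κ β ⟩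
      κ * 0# * 1# + (κ * β * 1# + 0#)          ∎
      where open ≈-Reasoning

    module T-conj = Conjugation {P = T} {Q = T⁻¹} (proj₁ T-inverse) (proj₂ T-inverse)
    module T⁻¹-conj = Conjugation {P = T⁻¹} {Q = T} (proj₂ T-inverse) (proj₁ T-inverse)

    TMT⁻¹≈κD : (T ⊗ (M ⊗ T⁻¹)) ≈M scal κ D
    TMT⁻¹≈κD = T-conj.intertwining⇒conj {A = M} T⊗M≈κD⊗T

    [κD]^k≈TM^kT⁻¹ : ∀ k → mpow (scal κ D) k ≈M (T ⊗ (mpow M k ⊗ T⁻¹))
    [κD]^k≈TM^kT⁻¹ k = ≈M.trans (mpow-cong (≈M.sym TMT⁻¹≈κD) k) (T-conj.conj-mpow M k)

    [κD]^k≈diag2 : ∀ k → mpow (scal κ D) k ≈M diag2 ((κ * 1#) ^ k) ((κ * β) ^ k)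
    [κD]^k≈diag2 k = ≈M.trans (mpow-cong (scal-diag2 κ 1# β) k) (mpow-diag2 (κ * 1#) (κ * β) k)

    [κ1]^k≈[κβ]^k⇔β^k≈1 : ∀ k → ((κ * 1#) ^ k ≈ (κ * β) ^ k) ⇔ (β ^ k ≈ 1#)
    [κ1]^k≈[κβ]^k⇔β^k≈1 k = mk⇔ to from
      where
      open ≈-Reasoning
      to : (κ * 1#) ^ k ≈ (κ * β) ^ k → β ^ k ≈ 1#
      to eq = sym (trans (sym (1^n≈1 k)) (*-cancelˡ (x^n≉0 k κ≉0) (begin
        κ ^ k * 1# ^ k  ≈⟨ ^-distrib-* κ 1# k ⟨
        (κ * 1#) ^ k    ≈⟨ eq ⟩
        (κ * β) ^ k     ≈⟨ ^-distrib-* κ β k ⟩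
        κ ^ k * β ^ k   ∎)))
      from : β ^ k ≈ 1# → (κ * 1#) ^ k ≈ (κ * β) ^ k
      from β^k≈1 = begin
        (κ * 1#) ^ k    ≈⟨ ^-distrib-* κ 1# k ⟩
        κ ^ k * 1# ^ k  ≈⟨ *-congˡ (trans (1^n≈1 k) (sym β^k≈1)) ⟩
        κ ^ k * β ^ k   ≈⟨ ^-distrib-* κ β k ⟨
        (κ * β) ^ k     ∎

    isScalar-M^k⇔β^k≈1 : ∀ k → IsScalar (mpow M k) ⇔ (β ^ k ≈ 1#)
    isScalar-M^k⇔β^k≈1 k = mk⇔
      (λ M^k-scalar → Equivalence.to ([κ1]^k≈[κβ]^k⇔β^k≈1 k) (isScalar-diag2⇒≈
        (isScalar-resp ([κD]^k≈diag2 k) (isScalar-resp (≈M.sym ([κD]^k≈TM^kT⁻¹ k)) (T-conj.isScalar-conj M^k-scalar)))))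
      (λ β^k≈1 → isScalar-resp (T-conj.conj-cancel (mpow M k)) (T⁻¹-conj.isScalar-conj
        (isScalar-resp ([κD]^k≈TM^kT⁻¹ k) (isScalar-resp (≈M.sym ([κD]^k≈diag2 k))
          (≈⇒isScalar-diag2 (Equivalence.from ([κ1]^k≈[κβ]^k⇔β^k≈1 k) β^k≈1))))))

    InSub-s : InSub q s
    InSub-s = InSub-+ m (InSub-1 q) (trans (frobenius m β β̄) (trans (+-congˡ β̄^q≈β) (+-comm β̄ β)))

    detM≉0 : ¬ s * 1# + 1# * 1# ≈ 0#
    detM≉0 detM≈0 = β≉β̄ (x+y≈0⇒x≈y (trans (sym detM≈β+β̄) detM≈0))
      where
      detM≈β+β̄ : s * 1# + 1# * 1# ≈ β + β̄
      detM≈β+β̄ = trans (solve 2 (λ β β̄ → (con 1 :+ (β :+ β̄)) :* con 1 :+ con 1 :* con 1 := (β :+ β̄) :+ (con 1 :+ con 1)) refl β β̄)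
                        (trans (+-congˡ 1+1≈0) (+-identityʳ _))

    M⁻¹ : Mat 2
    M⁻¹ = scal (inverse _ detM≉0) (mat2 1# 1# 1# s)

    M-singer : IsSinger q M
    M-singer = InSub-mat2 q InSub-s (InSub-1 q) (InSub-1 q) (InSub-1 q)
             , (M⁻¹ , InSub-scal q InSub-detM⁻¹ (InSub-mat2 q (InSub-1 q) (InSub-1 q) (InSub-1 q) InSub-s)
                    , mat2-inverse (x*inverse≈1 _ detM≉0))
             , Equivalence.from (isScalar-M^k⇔β^k≈1 (q ℕ.+ 1)) β^[q+1]≈1
             , λ k 0<k k<q+1 → β-order k 0<k k<q+1 ∘ Equivalence.to (isScalar-M^k⇔β^k≈1 k)
      where
      InSub-detM⁻¹ : InSub q (inverse _ detM≉0)
      InSub-detM⁻¹ = InSub-inverse q (x*inverse≈1 _ detM≉0)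
        (InSub-+ m (InSub-* q InSub-s (InSub-1 q)) (InSub-* q (InSub-1 q) (InSub-1 q)))

    P Q : Mat 4
    P = φ σ T
    Q = φ σ T⁻¹

    P-Q-inverse : InverseOf P Q
    P-Q-inverse = φ-inverse T-inverse

    μ : Carrier
    μ = κ ^ σ * κ

    μ≉0 : ¬ μ ≈ 0#
    μ≉0 = x*y≉0 (x^n≉0 σ κ≉0) κ≉0

    P⊗φM⊗Q≈μS : (P ⊗ (φ σ M ⊗ Q)) ≈M scal μ (diagS σ β)
    P⊗φM⊗Q≈μS = begin
      φ σ T ⊗ (φ σ M ⊗ φ σ T⁻¹)   ≈⟨ ⊗-cong {A = φ σ T} ≈M.refl (φ-⊗ M T⁻¹) ⟨
      φ σ T ⊗ φ σ (M ⊗ T⁻¹)       ≈⟨ φ-⊗ T (M ⊗ T⁻¹) ⟨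
      φ σ (T ⊗ (M ⊗ T⁻¹))         ≈⟨ φ-cong {T ⊗ (M ⊗ T⁻¹)} TMT⁻¹≈κD ⟩
      φ σ (scal κ D)              ≈⟨ φ-scal κ D ⟩
      scal μ (φ σ D)              ≈⟨ scal-cong refl (φ-diag2 β) ⟩
      scal μ (diagS σ β)          ∎
      where open ≈M-Reasoning

    -- T maps the point [1 : t] to [1 : u].
    infix 4 _↦_
    _↦_ : Carrier → Carrier → Set ℓ
    t ↦ u = β + t ≈ (β̄ + t) * u

    ↦-frobenius : ∀ {t u} → t ↦ u → β̄ + t ^ q ≈ (β + t ^ q) * u ^ q
    ↦-frobenius {t} {u} t↦u = begin
      β̄ + t ^ q               ≈⟨ frobenius m β t ⟨
      (β + t) ^ q             ≈⟨ ^-congˡ q t↦u ⟩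
      ((β̄ + t) * u) ^ q       ≈⟨ ^-distrib-* (β̄ + t) u q ⟩
      (β̄ + t) ^ q * u ^ q     ≈⟨ *-congʳ (trans (frobenius m β̄ t) (+-congʳ β̄^q≈β)) ⟩
      (β + t ^ q) * u ^ q     ∎
      where open ≈-Reasoning

    ↦⇒linear : ∀ {t u} → t ↦ u → (u + 1#) * t ≈ β + β̄ * u
    ↦⇒linear {t} {u} t↦u = begin
      (u + 1#) * t    ≈⟨ solve 2 (λ t u → (u :+ con 1) :* t := t :+ t :* u) refl t u ⟩
      t + t * u       ≈⟨ +-exchange (trans t↦u (distribʳ u β̄ t)) ⟨
      β + β̄ * u       ∎
      where open ≈-Reasoning

    linear⇒↦ : ∀ {t u} → (u + 1#) * t ≈ β + β̄ * u → t ↦ u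
    linear⇒↦ {t} {u} linear = begin
      β + t           ≈⟨ +-comm β t ⟩
      t + β           ≈⟨ +-exchange (trans (solve 2 (λ t u → t :+ t :* u := (u :+ con 1) :* t) refl t u) linear) ⟩
      t * u + β̄ * u   ≈⟨ +-comm _ _ ⟩
      β̄ * u + t * u   ≈⟨ distribʳ u β̄ t ⟨
      (β̄ + t) * u     ∎
      where open ≈-Reasoning

    u+1≉0 : ∀ {u} → ¬ u ≈ 1# → ¬ u + 1# ≈ 0#
    u+1≉0 u≉1 = u≉1 ∘ x+y≈0⇒x≈y

    ↦-unique : ∀ {t t′ u} → ¬ u ≈ 1# → t ↦ u → t′ ↦ u → t ≈ t′
    ↦-unique u≉1 t↦u t′↦u = *-cancelˡ (u+1≉0 u≉1) (trans (↦⇒linear t↦u) (sym (↦⇒linear t′↦u)))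

    ↦-norm : ∀ {t u} → InSub q t → t ↦ u → u ^ (q ℕ.+ 1) ≈ 1#
    ↦-norm {t} {u} t∈𝔽 t↦u = trans (x^[q+1]≈x*x^q u) (*-cancelˡ β+t≉0 (begin
      (β + t) * (u * u ^ q)   ≈⟨ x∙yz≈xz∙y (β + t) u (u ^ q) ⟩
      ((β + t) * u ^ q) * u   ≈⟨ *-congʳ frob ⟨
      (β̄ + t) * u             ≈⟨ t↦u ⟨
      β + t                   ≈⟨ *-identityʳ (β + t) ⟨
      (β + t) * 1#            ∎))
      where
      open ≈-Reasoning
      frob : β̄ + t ≈ (β + t) * u ^ q
      frob = trans (+-congˡ (sym t∈𝔽)) (trans (↦-frobenius t↦u) (*-congʳ (+-congˡ t∈𝔽)))
      β+t≉0 : ¬ β + t ≈ 0#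
      β+t≉0 β+t≈0 = β≉β̄ (trans β≈t (trans (sym t∈𝔽) (sym (^-congˡ q β≈t))))
        where
        β≈t : β ≈ t
        β≈t = x+y≈0⇒x≈y β+t≈0

    ↦-InSub : ∀ {t u} → ¬ u ≈ 1# → u ^ (q ℕ.+ 1) ≈ 1# → t ↦ u → InSub q t
    ↦-InSub {t} {u} u≉1 u^[q+1]≈1 t↦u = ↦-unique u≉1 tᵠ↦u t↦u
      where
      open ≈-Reasoning
      tᵠ↦u : t ^ q ↦ u
      tᵠ↦u = begin
        β + t ^ q                   ≈⟨ *-identityʳ _ ⟨
        (β + t ^ q) * 1#            ≈⟨ *-congˡ (trans (*-comm _ _) (trans (sym (x^[q+1]≈x*x^q u)) u^[q+1]≈1)) ⟨
        (β + t ^ q) * (u ^ q * u)   ≈⟨ *-assoc _ _ _ ⟨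
        (β + t ^ q) * u ^ q * u     ≈⟨ *-congʳ (↦-frobenius t↦u) ⟨
        (β̄ + t ^ q) * u             ∎

    β̄+t≉0 : ∀ {t} → InSub q t → ¬ β̄ + t ≈ 0#
    β̄+t≉0 {t} t∈𝔽 β̄+t≈0 = β≉β̄ (trans (sym β̄^q≈β) (trans (^-congˡ q β̄≈t) (trans t∈𝔽 (sym β̄≈t))))
      where
      β̄≈t : β̄ ≈ t
      β̄≈t = x+y≈0⇒x≈y β̄+t≈0

    image : ∀ {t} → InSub q t → ∃ λ u → t ↦ u
    image {t} t∈𝔽 = (β + t) * inverse (β̄ + t) (β̄+t≉0 t∈𝔽) , (begin
      β + t                                          ≈⟨ *-identityʳ _ ⟨
      (β + t) * 1#                                   ≈⟨ *-congˡ (x*inverse≈1 _ _) ⟨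
      (β + t) * ((β̄ + t) * inverse _ _)               ≈⟨ x∙yz≈y∙xz (β + t) (β̄ + t) _ ⟩
      (β̄ + t) * ((β + t) * inverse (β̄ + t) _)        ∎)
      where
      open ≈-Reasoning

    preimage : ∀ {u} → ¬ u ≈ 1# → ∃ λ t → t ↦ u
    preimage {u} u≉1 = inverse (u + 1#) (u+1≉0 u≉1) * (β + β̄ * u) , linear⇒↦ (begin
      (u + 1#) * (inverse (u + 1#) _ * (β + β̄ * u))   ≈⟨ *-assoc _ _ _ ⟨
      ((u + 1#) * inverse (u + 1#) _) * (β + β̄ * u)   ≈⟨ *-congʳ (x*inverse≈1 _ _) ⟩
      1# * (β + β̄ * u)                                ≈⟨ *-identityˡ _ ⟩
      β + β̄ * u                                       ∎)
      where open ≈-Reasoning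

    T·[1,t] : ∀ t → (T ·v vec2 1# t) ≈V vec2 (β̄ + t) (β + t)
    T·[1,t] t zero       = solve 2 (λ a t → a :* con 1 :+ (con 1 :* t :+ con 0) := a :+ t) refl β̄ t
    T·[1,t] t (suc zero) = solve 2 (λ a t → a :* con 1 :+ (con 1 :* t :+ con 0) := a :+ t) refl β t

    T·[0,1] : (T ·v vec2 0# 1#) ≈V vec2 1# 1#
    T·[0,1] zero       = solve 1 (λ a → a :* con 0 :+ (con 1 :* con 1 :+ con 0) := con 1) refl β̄
    T·[0,1] (suc zero) = solve 1 (λ a → a :* con 0 :+ (con 1 :* con 1 :+ con 0) := con 1) refl β

    P·curvePt : ∀ t → (P ·v curvePt σ t) ≈V tens (vec2 (β̄ + t) (β + t))
    P·curvePt t = ≈V.trans (·v-cong {A = P} ≈M.refl (curvePt≈tens t))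
                    (≈V.trans (φ-tens T (vec2 1# t)) (tens-cong (T·[1,t] t)))

    P·e₄ : (P ·v vec4 0# 0# 0# 1#) ≈V tens (vec2 1# 1#)
    P·e₄ = ≈V.trans (·v-cong {A = P} ≈M.refl e₄≈tens) (≈V.trans (φ-tens T (vec2 0# 1#)) (tens-cong T·[0,1]))

    proportional-to-curvePt : ∀ {v a b u w} → (P ·v v) ≈V tens (vec2 a b) → ¬ a ≈ 0# → b ≈ a * u →
                   w ≈V curvePt σ u → Proportional (P ·v v) w
    proportional-to-curvePt {a = a} Pv≈ a≉0 b≈au w≈ =
      a ^ σ * a , x*y≉0 (x^n≉0 σ a≉0) a≉0 , λ r → trans (Pv≈ r) (trans (tens-vec2 b≈au r) (*-congˡ (sym (w≈ r))))

    P-maps-A-onto-M : MapsOnto P (InA q σ) (InM (q ℕ.+ 1) σ)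
    P-maps-A-onto-M = A→M , M→A
      where
      A→M : ∀ v → InA q σ v → ∃ λ w → InM (q ℕ.+ 1) σ w × Proportional (P ·v v) w
      A→M v (inj₁ (t , t∈𝔽 , v≈)) = curvePt σ u , (u , ↦-norm t∈𝔽 t↦u , ≈V.refl)
                                  , proportional-to-curvePt {v} (≈V.trans (·v-cong {A = P} ≈M.refl v≈) (P·curvePt t)) (β̄+t≉0 t∈𝔽) t↦u ≈V.refl
        where
        u : Carrier
        u = proj₁ (image t∈𝔽)
        t↦u : t ↦ u
        t↦u = proj₂ (image t∈𝔽)
      A→M v (inj₂ v≈e₄) = curvePt σ 1# , (1# , 1^n≈1 (q ℕ.+ 1) , ≈V.refl)
                        , proportional-to-curvePt {v} (≈V.trans (·v-cong {A = P} ≈M.refl v≈e₄) P·e₄) 1≉0 (sym (*-identityˡ 1#)) ≈V.refl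

      M→A : ∀ w → InM (q ℕ.+ 1) σ w → ∃ λ v → InA q σ v × Proportional (P ·v v) w
      M→A w (u , u^[q+1]≈1 , w≈) with u ≟K 1#
      ... | yes u≈1 = vec4 0# 0# 0# 1# , inj₂ ≈V.refl
                    , proportional-to-curvePt {vec4 0# 0# 0# 1#} P·e₄ 1≉0 (sym (trans (*-identityˡ u) u≈1)) w≈
      ... | no u≉1 = curvePt σ t , inj₁ (t , t∈𝔽 , ≈V.refl)
                   , proportional-to-curvePt {curvePt σ t} (P·curvePt t) (β̄+t≉0 t∈𝔽) t↦u w≈
        where
        t : Carrier
        t = proj₁ (preimage u≉1)
        t↦u : t ↦ u
        t↦u = proj₂ (preimage u≉1)
        t∈𝔽 : InSub q t
        t∈𝔽 = ↦-InSub u≉1 u^[q+1]≈1 t↦u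

2∣2^m : ∀ {m} → 1 ≤ m → 2 ∣ 2 ℕ.^ m
2∣2^m {suc m} _ = m∣m*n (2 ℕ.^ m)

lemma3p2 : ∀ {c ℓ : Level} (m e : ℕ) → 3 ≤ m → gcd e m ≡ 1 →
  (K : CommutativeRing c ℓ) → let open FieldTheory K in
  IsField → HasSize (2 ℕ.^ m ℕ.* 2 ℕ.^ m) →
  (β : Carrier) → β ^ (2 ℕ.^ m ℕ.+ 1) ≈ 1# →
  (∀ k → 0 < k → k < 2 ℕ.^ m ℕ.+ 1 → ¬ (β ^ k ≈ 1#)) →
  ∃ λ P → ∃ λ Q → InverseOf P Q ×
    MapsOnto P (InA (2 ℕ.^ m) (2 ℕ.^ e)) (InM (2 ℕ.^ m ℕ.+ 1) (2 ℕ.^ e)) ×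
    (∃ λ M → IsSinger (2 ℕ.^ m) M ×
      (∃ λ μ → (¬ (μ ≈ 0#)) × ((P ⊗ (φ (2 ℕ.^ e) M ⊗ Q)) ≈M scal μ (diagS (2 ℕ.^ e) β))))
lemma3p2 m e 3≤m _ K isField size β β^[q+1]≈1 β-order =
  P , Q , P-Q-inverse , P-maps-A-onto-M , M , M-singer , μ , μ≉0 , P⊗φM⊗Q≈μS
  where
  open FieldTheory K using (_+_; _≈_; 1#; 0#)
  1≤m : 1 ≤ m
  1≤m = ℕₚ.≤-trans (ℕ.s≤s ℕ.z≤n) 3≤m
  char2 : 1# + 1# ≈ 0#
  char2 = evenSize⇒char2 K size isField (∣m⇒∣m*n (2 ℕ.^ m) (2∣2^m 1≤m))
  open SingerConjugation K isField char2 (≈-dec K size) m 1≤m e β β^[q+1]≈1 β-order
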